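{- Let $G$ be an equatorial graph with girth $g$ and equator $q$, let $k=\lceil g/2\rceil-1$, let $C=u_0,\dots,u_{q-1}$ be an isometric cycle of length $q$ in $G$, and let $L_i=\mathcal{D}_k(u_{i-k})\cap\mathcal{D}_k(u_{i+k})$ for $i\in\{0,\dots,q-1\}$ (indices mod $q$). If a vertex of $L_i$ is adjacent to a vertex of $L_j$, then $|j-i|\le 1$, where the difference is taken mod $q$ (i.e. $j\in\{i-1,i,i+1\}$ mod $q$).
   Context: For a vertex $u$, $\mathcal{D}_i(u)=\{v: d(u,v)\le i\}$. A cycle $C$ is isometric if $d_C(x,y)=d_G(x,y)$ for all $x,y\in V(C)$; the equator is the length of a longest isometric cycle. For $\delta\ge2$, $g\ge3$, $k=\lceil g/2\rceil-1$, the Moore bound is $M(\delta,g)=1+\sum_{i=0}^{k-1}\delta(\delta-1)^i$ for odd $g$ and $M(\delta,g)=2+\sum_{i=1}^{k}2(\delta-1)^i$ for even $g$. An equatorial graph is a finite graph with girth $g$, minimum degree $\delta$ and equator $q>6k+3$ whose order is exactly $\frac{q}{g}M(\delta,g)$. -}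

module Defs where

open import Data.Nat using (ℕ; zero; suc; _+_; _*_; _∸_; _^_; _≤_; _<_; _/_; _%_)
open import Data.Nat.DivMod using (_mod_)
open import Data.Bool using (Bool; true; false; if_then_else_)
open import Data.Fin using (Fin; toℕ)
open import Data.List using (map; allFin)
open import Data.Nat.ListAction using (sum)
open import Data.Product using (Σ; ∃; _×_)
open import Relation.Binary.PropositionalEquality using (_≡_)
open import Relation.Nullary using (¬_)
open import Function.Definitions using (Injective)

record Graph (n : ℕ) : Set where
  field
    adj   : Fin n → Fin n → Bool
    sym   : ∀ u v → adj u v ≡ adj v u
    loopless : ∀ v → adj v v ≡ false
open Graph public

Adj : ∀ {n} → Graph n → Fin n → Fin n → Set
Adj G u v = adj G u v ≡ true

degree : ∀ {n} → Graph n → Fin n → ℕ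
degree {n} G u = sum (map (λ v → if adj G u v then 1 else 0) (allFin n))

MinDegree : ∀ {n} → Graph n → ℕ → Set
MinDegree G δ = (∃ λ v → degree G v ≡ δ) × (∀ v → δ ≤ degree G v)

data Walk {n} (G : Graph n) : Fin n → Fin n → ℕ → Set where
  nil  : ∀ {u} → Walk G u u 0
  cons : ∀ {u w v m} → Adj G u w → Walk G w v m → Walk G u v (suc m)

Dist : ∀ {n} → Graph n → Fin n → Fin n → ℕ → Set
Dist G u v m = Walk G u v m × (∀ m' → m' < m → ¬ Walk G u v m')

InBall : ∀ {n} → Graph n → ℕ → Fin n → Fin n → Set
InBall G i u v = ∃ λ m → m ≤ i × Dist G u v m

fwd : ∀ {ℓ} → Fin ℓ → ℕ → Fin ℓ
fwd {suc m} i k = (toℕ i + k) mod suc m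

back : ∀ {ℓ} → Fin ℓ → ℕ → Fin ℓ
back {suc m} i k = (toℕ i + k * m) mod suc m   -- k*m ≡ -k (mod m+1)

IsCycle : ∀ {n} → Graph n → (ℓ : ℕ) → (Fin ℓ → Fin n) → Set
IsCycle G ℓ c = 3 ≤ ℓ × Injective _≡_ _≡_ c × (∀ i → Adj G (c i) (c (fwd i 1)))

cycDist : ∀ {ℓ} → Fin ℓ → Fin ℓ → ℕ
cycDist {ℓ} a b = let d = toℕ (back b (toℕ a)) in
  Data.Nat._⊓_ d (ℓ ∸ d)

IsIsometricCycle : ∀ {n} → Graph n → (ℓ : ℕ) → (Fin ℓ → Fin n) → Set
IsIsometricCycle G ℓ c = IsCycle G ℓ c × (∀ a b → Dist G (c a) (c b) (cycDist a b))

HasGirth : ∀ {n} → Graph n → ℕ → Set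
HasGirth {n} G g = (Σ (Fin g → Fin n) λ c → IsCycle G g c)
  × (∀ ℓ (c : Fin ℓ → Fin n) → IsCycle G ℓ c → g ≤ ℓ)

HasEquator : ∀ {n} → Graph n → ℕ → Set
HasEquator {n} G q = (Σ (Fin q → Fin n) λ c → IsIsometricCycle G q c)
  × (∀ ℓ (c : Fin ℓ → Fin n) → IsIsometricCycle G ℓ c → ℓ ≤ q)

sumTo : (ℕ → ℕ) → ℕ → ℕ
sumTo f zero = 0
sumTo f (suc k) = sumTo f k + f k

-- k = ⌈g/2⌉ - 1 = ⌊(g-1)/2⌋
kOf : ℕ → ℕ
kOf g = (g ∸ 1) / 2

moore : ℕ → ℕ → ℕ
moore δ g = if Data.Nat._≡ᵇ_ (g % 2) 1
  then 1 + sumTo (λ i → δ * (δ ∸ 1) ^ i) (kOf g)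
  else 2 + sumTo (λ i → 2 * (δ ∸ 1) ^ suc i) (kOf g)

-- equatorial graph with girth g, minimum degree δ ≥ 2 and equator q:
-- q > 6k+3 and |V| = (q/g)·M(δ,g), i.e. |V|·g = q·M(δ,g)
Equatorial : ∀ {n} → Graph n → (g δ q : ℕ) → Set
Equatorial {n} G g δ q =
  HasGirth G g × MinDegree G δ × 2 ≤ δ × HasEquator G q
  × 6 * kOf g + 3 < q × n * g ≡ q * moore δ g

InL : ∀ {n q} → Graph n → ℕ → (Fin q → Fin n) → Fin q → Fin n → Set
InL G k u i v = InBall G k (u (back i k)) v × InBall G k (u (fwd i k)) v

{-# OPTIONS --safe #-}
module Submission where

-- Let t = j − i mod q. For a ∈ {i − k, i + k} and b ∈ {j − k, j + k} the walk u_a ⇝ x — y ⇝ u_b has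
-- length at most 2k + 1, and C is isometric, so the displacements t (a = i − k, b = j − k),
-- t + 2k (a = i − k, b = j + k) and t − 2k (a = i + k, b = j − k) are all within 2k + 1 of 0 mod q.
-- If t ≤ 2k + 1 then t + 2k does not wrap around, so t ≤ 1; if q − t ≤ 2k + 1 then neither does
-- t − 2k, so q − t ≤ 1. Every other alternative forces q ≤ 6k + 2.

open import Defs
open import Data.Nat using (ℕ; zero; suc; _+_; _*_; _∸_; _≤_; _<_; _%_; _/_; _⊓_; NonZero; s≤s; s≤s⁻¹)
open import Data.Nat.Properties
open import Data.Nat.DivMod using (m≡m%n+[m/n]*n; [m+kn]%n≡m%n; m<n⇒m%n≡m)
open import Data.Nat.Tactic.RingSolver using (solve-∀)
open import Data.Fin using (Fin; toℕ)
open import Data.Fin.Properties using (toℕ-fromℕ<; toℕ-injective; toℕ<n)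
open import Data.Product using (_,_)
open import Data.Sum using (_⊎_; inj₁; inj₂; map₂)
open import Data.Empty using (⊥-elim)
open import Relation.Binary.PropositionalEquality using (_≡_; trans; cong; cong₂; subst; module ≡-Reasoning)
import Relation.Binary.PropositionalEquality as ≡

module _ {n} (G : Graph n) where

  Adj-sym : ∀ {u v} → Adj G u v → Adj G v u
  Adj-sym {u} {v} u~v = trans (Graph.sym G v u) u~v

  _++ᵂ_ : ∀ {u v w a b} → Walk G u v a → Walk G v w b → Walk G u w (a + b)
  nil      ++ᵂ q = q
  cons e p ++ᵂ q = cons e (p ++ᵂ q)

  snocᵂ : ∀ {u v w a} → Walk G u v a → Adj G v w → Walk G u w (suc a)
  snocᵂ nil        e = cons e nil
  snocᵂ (cons f p) e = cons f (snocᵂ p e)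

  reverseᵂ : ∀ {u v a} → Walk G u v a → Walk G v u a
  reverseᵂ nil        = nil
  reverseᵂ (cons e p) = snocᵂ (reverseᵂ p) (Adj-sym e)

  Dist≤length : ∀ {u v d m} → Dist G u v d → Walk G u v m → d ≤ m
  Dist≤length (_ , shortest) w = ≮⇒≥ (λ m<d → shortest _ m<d w)

  Dist≤across-edge : ∀ k {a b x y d} → Dist G a b d →
    InBall G k a x → InBall G k b y → Adj G x y → d ≤ suc (k + k)
  Dist≤across-edge k dist (m₁ , m₁≤k , (a⇝x , _)) (m₂ , m₂≤k , (b⇝y , _)) x~y =
    ≤-trans (Dist≤length dist (a⇝x ++ᵂ cons x~y (reverseᵂ b⇝y))) length≤
    where
      length≤ : m₁ + suc m₂ ≤ suc (k + k)
      length≤ = subst (_≤ suc (k + k)) (≡.sym (+-suc m₁ m₂)) (s≤s (+-mono-≤ m₁≤k m₂≤k))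

m+kn≡o+ln⇒m%n≡o%n : ∀ {m o} k l n .{{_ : NonZero n}} → m + k * n ≡ o + l * n → m % n ≡ o % n
m+kn≡o+ln⇒m%n≡o%n {m} {o} k l n eq = begin
  m % n           ≡⟨ ≡.sym ([m+kn]%n≡m%n m k n) ⟩
  (m + k * n) % n ≡⟨ cong (_% n) eq ⟩
  (o + l * n) % n ≡⟨ [m+kn]%n≡m%n o l n ⟩
  o % n           ∎
  where open ≡-Reasoning

[m%n+o]%n≡[m+o]%n : ∀ m o n .{{_ : NonZero n}} → (m % n + o) % n ≡ (m + o) % n
[m%n+o]%n≡[m+o]%n m o n = m+kn≡o+ln⇒m%n≡o%n (m / n) 0 n (begin
  m % n + o + m / n * n     ≡⟨ shuffle (m % n) o (m / n * n) ⟩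
  m % n + m / n * n + o + 0 ≡⟨ cong (λ x → x + o + 0) (≡.sym (m≡m%n+[m/n]*n m n)) ⟩
  m + o + 0                 ∎)
  where
    open ≡-Reasoning
    shuffle : ∀ r o s → r + o + s ≡ r + s + o + 0
    shuffle = solve-∀

[m%n+[o%n]*p]%n≡[m+o*p]%n : ∀ m o p n .{{_ : NonZero n}} →
  (m % n + (o % n) * p) % n ≡ (m + o * p) % n
[m%n+[o%n]*p]%n≡[m+o*p]%n m o p n = m+kn≡o+ln⇒m%n≡o%n (m / n + (o / n) * p) 0 n (begin
  m % n + o % n * p + (m / n + o / n * p) * n
    ≡⟨ shuffle (m % n) (o % n) (m / n) (o / n) p n ⟩
  (m % n + m / n * n) + (o % n + o / n * n) * p + 0
    ≡⟨ ≡.sym (cong₂ (λ x y → x + y * p + 0) (m≡m%n+[m/n]*n m n) (m≡m%n+[m/n]*n o n)) ⟩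
  m + o * p + 0
    ∎)
  where
    open ≡-Reasoning
    shuffle : ∀ r s a b p n → r + s * p + (a + b * p) * n ≡ (r + a * n) + (s + b * n) * p + 0
    shuffle = solve-∀

-- back i c is definitionally fwd i (c * m) on Fin (suc m), and c * m ≡ −c mod suc m; so offset i j
-- is j − i mod q, and cycDist a b unfolds to cycLen q (offset a b).
offset : ∀ {q} → Fin q → Fin q → ℕ
offset i j = toℕ (back j (toℕ i))

cycLen : ℕ → ℕ → ℕ
cycLen q d = d ⊓ (q ∸ d)

cycLen≤r⇒d≤r⊎q≤d+r : ∀ q {d r} → cycLen q d ≤ r → d ≤ r ⊎ q ≤ d + r
cycLen≤r⇒d≤r⊎q≤d+r q {d} {r} len≤r with ⊓-sel d (q ∸ d)
... | inj₁ len≡d   = inj₁ (subst (_≤ r) len≡d len≤r)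
... | inj₂ len≡q∸d = inj₂ (≤-trans (m≤n+m∸n q d) (+-monoʳ-≤ d (subst (_≤ r) len≡q∸d len≤r)))

module _ {m : ℕ} where

  toℕ-fwd : ∀ (i : Fin (suc m)) c → toℕ (fwd i c) ≡ (toℕ i + c) % suc m
  toℕ-fwd i c = toℕ-fromℕ< _

  offset-fwd-fwd : ∀ (i j : Fin (suc m)) a b →
    offset (fwd i a) (fwd j b) ≡ (offset i j + (b + a * m)) % suc m
  offset-fwd-fwd i j a b = begin
    offset (fwd i a) (fwd j b)
      ≡⟨ toℕ-fwd (fwd j b) (toℕ (fwd i a) * m) ⟩
    (toℕ (fwd j b) + toℕ (fwd i a) * m) % suc m
      ≡⟨ cong₂ (λ x y → (x + y * m) % suc m) (toℕ-fwd j b) (toℕ-fwd i a) ⟩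
    ((J + b) % suc m + ((I + a) % suc m) * m) % suc m
      ≡⟨ [m%n+[o%n]*p]%n≡[m+o*p]%n (J + b) (I + a) m (suc m) ⟩
    (J + b + (I + a) * m) % suc m
      ≡⟨ cong (_% suc m) (shuffle J b I a m) ⟩
    (J + I * m + (b + a * m)) % suc m
      ≡⟨ ≡.sym ([m%n+o]%n≡[m+o]%n (J + I * m) (b + a * m) (suc m)) ⟩
    ((J + I * m) % suc m + (b + a * m)) % suc m
      ≡⟨ cong (λ t → (t + (b + a * m)) % suc m) (≡.sym (toℕ-fwd j (I * m))) ⟩
    (offset i j + (b + a * m)) % suc m
      ∎
    where
      open ≡-Reasoning
      I J : ℕ
      I = toℕ i
      J = toℕ j
      shuffle : ∀ J b I a m → J + b + (I + a) * m ≡ J + I * m + (b + a * m)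
      shuffle = solve-∀

  offset-back-back : ∀ (i j : Fin (suc m)) k → offset (back i k) (back j k) ≡ offset i j
  offset-back-back i j k = begin
    offset (back i k) (back j k)           ≡⟨ offset-fwd-fwd i j (k * m) (k * m) ⟩
    (t + (k * m + k * m * m)) % suc m      ≡⟨ cong (λ x → (t + x) % suc m) (≡.sym (*-suc (k * m) m)) ⟩
    (t + k * m * suc m) % suc m            ≡⟨ [m+kn]%n≡m%n t (k * m) (suc m) ⟩
    t % suc m                              ≡⟨ m<n⇒m%n≡m (toℕ<n (back j (toℕ i))) ⟩
    t                                      ∎
    where
      open ≡-Reasoning
      t : ℕ
      t = offset i j

  offset-back-fwd : ∀ (i j : Fin (suc m)) k →
    offset (back i k) (fwd j k) ≡ (offset i j + (k + k)) % suc m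
  offset-back-fwd i j k = trans (offset-fwd-fwd i j (k * m) k)
    (m+kn≡o+ln⇒m%n≡o%n k (k * m) (suc m) (shuffle (offset i j) k m))
    where
      shuffle : ∀ t k m → t + (k + k * m * m) + k * suc m ≡ t + (k + k) + k * m * suc m
      shuffle = solve-∀

  offset-fwd-back : ∀ (i j : Fin (suc m)) k →
    offset (fwd i k) (back j k) ≡ (offset i j + (k + k) * m) % suc m
  offset-fwd-back i j k = trans (offset-fwd-fwd i j k (k * m))
    (cong (λ x → (offset i j + x) % suc m) (≡.sym (*-distribʳ-+ m k k)))

  fwd-zero : ∀ (i : Fin (suc m)) → fwd i 0 ≡ i
  fwd-zero i = toℕ-injective (trans (toℕ-fwd i 0)
    (trans (cong (_% suc m) (+-identityʳ (toℕ i))) (m<n⇒m%n≡m (toℕ<n i))))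

  fwd-offset : ∀ (i j : Fin (suc m)) → fwd i (offset i j) ≡ j
  fwd-offset i j = toℕ-injective (begin
    toℕ (fwd i (offset i j))              ≡⟨ toℕ-fwd i (offset i j) ⟩
    (I + offset i j) % suc m              ≡⟨ cong (λ t → (I + t) % suc m) (toℕ-fwd j (I * m)) ⟩
    (I + (J + I * m) % suc m) % suc m     ≡⟨ cong (_% suc m) (+-comm I _) ⟩
    ((J + I * m) % suc m + I) % suc m     ≡⟨ [m%n+o]%n≡[m+o]%n (J + I * m) I (suc m) ⟩
    (J + I * m + I) % suc m               ≡⟨ cong (_% suc m) (shuffle J I m) ⟩
    (J + I * suc m) % suc m               ≡⟨ [m+kn]%n≡m%n J I (suc m) ⟩
    J % suc m                             ≡⟨ m<n⇒m%n≡m (toℕ<n j) ⟩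
    J                                     ∎)
    where
      open ≡-Reasoning
      I J : ℕ
      I = toℕ i
      J = toℕ j
      shuffle : ∀ J I m → J + I * m + I ≡ J + I * suc m
      shuffle = solve-∀

  neighbours-by-offset : ∀ (i j : Fin (suc m)) →
    offset i j ≡ 0 ⊎ offset i j ≡ 1 ⊎ offset i j ≡ m →
    j ≡ back i 1 ⊎ j ≡ i ⊎ j ≡ fwd i 1
  neighbours-by-offset i j = conclude
    where
      j≡fwd : ∀ {c} → offset i j ≡ c → j ≡ fwd i c
      j≡fwd t≡c = trans (≡.sym (fwd-offset i j)) (cong (fwd i) t≡c)

      conclude : offset i j ≡ 0 ⊎ offset i j ≡ 1 ⊎ offset i j ≡ m →
        j ≡ back i 1 ⊎ j ≡ i ⊎ j ≡ fwd i 1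
      conclude (inj₁ t≡0)        = inj₂ (inj₁ (trans (j≡fwd t≡0) (fwd-zero i)))
      conclude (inj₂ (inj₁ t≡1)) = inj₂ (inj₂ (j≡fwd t≡1))
      conclude (inj₂ (inj₂ t≡m)) = inj₁ (j≡fwd (trans t≡m (≡.sym (*-identityˡ m))))

module _ {m : ℕ} (k : ℕ) (6k+2<q : 6 * k + 2 < suc m) where

  private
    K : ℕ
    K = suc (k + k)

    Near : ℕ → Set
    Near d = cycLen (suc m) d ≤ K

    <q : ∀ {x} → x ≤ K + (k + k) + K → x < suc m
    <q x≤ = ≤-<-trans (≤-trans x≤ (≤-reflexive (six k))) 6k+2<q
      where
        six : ∀ k → suc (k + k) + (k + k) + suc (k + k) ≡ 6 * k + 2
        six = solve-∀

  near-start⇒≤1 : ∀ {t} → t ≤ suc (k + k) →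
    cycLen (suc m) ((t + (k + k)) % suc m) ≤ suc (k + k) → t ≤ 1
  near-start⇒≤1 {t} t≤K near =
    cases (cycLen≤r⇒d≤r⊎q≤d+r (suc m) (subst Near t+2k%q≡t+2k near))
    where
      t+2k≤K+2k : t + (k + k) ≤ K + (k + k)
      t+2k≤K+2k = +-monoˡ-≤ (k + k) t≤K

      t+2k%q≡t+2k : (t + (k + k)) % suc m ≡ t + (k + k)
      t+2k%q≡t+2k = m<n⇒m%n≡m (<q (≤-trans t+2k≤K+2k (m≤m+n _ K)))

      cases : t + (k + k) ≤ K ⊎ suc m ≤ t + (k + k) + K → t ≤ 1
      cases (inj₁ t+2k≤K)   = +-cancelʳ-≤ (k + k) t 1 t+2k≤K
      cases (inj₂ q≤t+2k+K) = ⊥-elim (<⇒≱ (<q (+-monoˡ-≤ K t+2k≤K+2k)) q≤t+2k+K)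

  near-end⇒≡m : ∀ {t} → t < suc m → suc m ≤ t + suc (k + k) →
    cycLen (suc m) ((t + (k + k) * m) % suc m) ≤ suc (k + k) → t ≡ m
  near-end⇒≡m {t} t<q q≤t+K near =
    cases (cycLen≤r⇒d≤r⊎q≤d+r (suc m) (subst Near t-2k%q≡t∸2k near))
    where
      <q′ : ∀ {x} → x ≤ k + k + K + K → x < suc m
      <q′ x≤ = <q (≤-trans x≤ (≤-reflexive (cong (_+ K) (+-comm (k + k) K))))

      2k≤t : k + k ≤ t
      2k≤t = ≮⇒≥ (λ t<2k → <⇒≱ (<q′ (≤-trans (+-monoˡ-≤ K (<⇒≤ t<2k)) (m≤m+n _ K))) q≤t+K)

      s : ℕ
      s = t ∸ (k + k)

      t≡2k+s : t ≡ k + k + s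
      t≡2k+s = ≡.sym (m+[n∸m]≡n 2k≤t)

      t-2k%q≡t∸2k : (t + (k + k) * m) % suc m ≡ s
      t-2k%q≡t∸2k = begin
        (t + (k + k) * m) % suc m          ≡⟨ cong (λ x → (x + (k + k) * m) % suc m) t≡2k+s ⟩
        (k + k + s + (k + k) * m) % suc m  ≡⟨ cong (_% suc m) (shuffle (k + k) s m) ⟩
        (s + (k + k) * suc m) % suc m      ≡⟨ [m+kn]%n≡m%n s (k + k) (suc m) ⟩
        s % suc m                          ≡⟨ m<n⇒m%n≡m (≤-<-trans (m∸n≤m t (k + k)) t<q) ⟩
        s                                  ∎
        where
          open ≡-Reasoning
          shuffle : ∀ a s m → a + s + a * m ≡ s + a * suc m
          shuffle = solve-∀

      s+K≡1+t : s + K ≡ suc t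
      s+K≡1+t = trans (+-suc s (k + k)) (cong suc (trans (+-comm s (k + k)) (≡.sym t≡2k+s)))

      cases : s ≤ K ⊎ suc m ≤ s + K → t ≡ m
      cases (inj₁ s≤K) = ⊥-elim (<⇒≱ (<q′ t+K≤2k+K+K) q≤t+K)
        where
          t+K≤2k+K+K : t + K ≤ k + k + K + K
          t+K≤2k+K+K = +-monoˡ-≤ K (subst (_≤ k + k + K) (≡.sym t≡2k+s) (+-monoʳ-≤ (k + k) s≤K))
      cases (inj₂ q≤s+K) = ≤-antisym (s≤s⁻¹ t<q) (s≤s⁻¹ (subst (suc m ≤_) s+K≡1+t q≤s+K))

  near-0-±2k⇒0⊎1⊎m : ∀ {t} → t < suc m → cycLen (suc m) t ≤ suc (k + k) →
    cycLen (suc m) ((t + (k + k)) % suc m) ≤ suc (k + k) →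
    cycLen (suc m) ((t + (k + k) * m) % suc m) ≤ suc (k + k) →
    t ≡ 0 ⊎ t ≡ 1 ⊎ t ≡ m
  near-0-±2k⇒0⊎1⊎m {t} t<q near near₊ near₋ with cycLen≤r⇒d≤r⊎q≤d+r (suc m) near
  ... | inj₁ t≤K   = map₂ inj₁ (n≤1⇒n≡0∨n≡1 (near-start⇒≤1 t≤K near₊))
  ... | inj₂ q≤t+K = inj₂ (inj₂ (near-end⇒≡m t<q q≤t+K near₋))

lemma18 : ∀ {n} (G : Graph n) (g δ q : ℕ) → Equatorial G g δ q →
    (u : Fin q → Fin n) → IsIsometricCycle G q u →
    ∀ (i j : Fin q) (x y : Fin n) →
    InL G (kOf g) u i x → InL G (kOf g) u j y → Adj G x y →
    j ≡ back i 1 ⊎ j ≡ i ⊎ j ≡ fwd i 1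
lemma18 G g δ zero _ u _ () j x y _ _ _
lemma18 G g δ (suc m) (_ , _ , _ , _ , 6k+3<q , _) u (_ , isometric) i j x y
        (x∈⁻ , x∈⁺) (y∈⁻ , y∈⁺) x~y =
  neighbours-by-offset i j (near-0-±2k⇒0⊎1⊎m k 6k+2<q (toℕ<n (back j (toℕ i))) near₀ near₊ near₋)
  where
    k : ℕ
    k = kOf g

    6k+2<q : 6 * k + 2 < suc m
    6k+2<q = <-trans (+-monoʳ-< (6 * k) (n<1+n 2)) 6k+3<q

    Near : ℕ → Set
    Near d = cycLen (suc m) d ≤ suc (k + k)

    across : ∀ {a b x′ y′} → InBall G k (u a) x′ → InBall G k (u b) y′ → Adj G x′ y′ →
      Near (offset a b)
    across {a} {b} = Dist≤across-edge G k (isometric a b)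

    near₀ : Near (offset i j)
    near₀ = subst Near (offset-back-back i j k) (across x∈⁻ y∈⁻ x~y)

    near₊ : Near ((offset i j + (k + k)) % suc m)
    near₊ = subst Near (offset-back-fwd i j k) (across x∈⁻ y∈⁺ x~y)

    near₋ : Near ((offset i j + (k + k) * m) % suc m)
    near₋ = subst Near (offset-fwd-back i j k) (across x∈⁺ y∈⁻ x~y)
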